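{- Let $n\ge 2$ and let $\mathcal{C}$ be the set of all levellised $n$-lattices that are pairwise isomorphic as unlabelled lattices (i.e. the levellised $n$-lattices in one isomorphism class). Then the relation $<$ defined below is a (strict) total order on $\mathcal{C}$.
   Context: An $n$-poset ($n\ge2$) is a finite poset whose $n$ elements are labelled $0,1,\ldots,n-1$, where $0$ is the least element and $1$ is the greatest element; an $n$-lattice is an $n$-poset that is a lattice. Write $\preceq_L$ for the order of $L$. For $a\in L$, $\mathrm{cov}_L(a)$ is the set of elements of $L$ covering $a$. The depth $\mathrm{dep}_L(a)$ is the integer $p$ such that $p+1$ is the maximum number of elements of a chain in $L$ with least element $a$ and greatest element $1$ (so $\mathrm{dep}_L(1)=0$). The $k$-th level is $\mathrm{lev}_k(L)=\{a\in L:\mathrm{dep}_L(a)=k\}$. $L$ is levellised if $\mathrm{dep}_L(i)\le\mathrm{dep}_L(j)$ whenever $0<i\le j<n$. For a set $A$ of labels, $\mathrm{wt}(A)=\sum_{j\in A}2^j$. For $i\in L\setminus\{0\}$ and an integer $d$, $\mathrm{cov}^d_L(i)=\mathrm{cov}_L(i)\cap\mathrm{lev}_d(L)$. For a levellised $n$-lattice $L$ with $n>2$ and $k=\mathrm{dep}_L(n-1)$, $L'$ denotes the subposet of $L$ induced by all elements of depth $\neq k$ (i.e. $L$ with its last non-trivial level removed); it is a levellised $n'$-lattice for some $n'<n$. The relation $<$ is defined by induction on $n$ on sets of levellised $n$-lattices isomorphic as unlabelled lattices (for $n=2$ there is only one such lattice). For $n>2$ and such $L_1,L_2$, $L_1<L_2$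 holds iff either $L_1'<L_2'$, or $L_1'=L_2'=:L'$ and, writing $k=\mathrm{dep}_{L_1}(n-1)=\mathrm{dep}_{L_2}(n-1)$ and $\mathrm{lev}_k(L_1)=\mathrm{lev}_k(L_2)=\{a_k,\ldots,n-1\}$, there exist $\ell\in\{1,\ldots,k-1\}$ and $i\in\{a_k,\ldots,n-1\}$ such that $\mathrm{wt}(\mathrm{cov}^d_{L_1}(j))=\mathrm{wt}(\mathrm{cov}^d_{L_2}(j))$ whenever either $d>\ell$ (and $j\in\{a_k,\ldots,n-1\}$), or $d=\ell$ and $j\in\{a_k,\ldots,i-1\}$; and $\mathrm{wt}(\mathrm{cov}^\ell_{L_1}(i))<\mathrm{wt}(\mathrm{cov}^\ell_{L_2}(i))$. (Here $d$ ranges over $\{1,\ldots,k-1\}$.) -}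

module Defs where

open import Data.Nat using (ℕ; zero; suc; _+_; _∸_; _^_; _≤_; _<_)
open import Data.Bool using (Bool; T)
open import Data.Product using (Σ; ∃; ∃-syntax; _×_)
open import Data.Empty using (⊥)
open import Data.Sum using (_⊎_)
open import Relation.Nullary using (¬_)
open import Relation.Binary.PropositionalEquality using (_≡_; _≢_)

-- An n-poset is represented by its size n and a Boolean order relation
-- R on labels ℕ; only labels 0,…,n-1 are elements, R i j = true means
-- i ⪯ j.  Values of R outside {0..n-1}² are irrelevant junk.

Ord : Set
Ord = ℕ → ℕ → Bool

module _ (n : ℕ) (R : Ord) where

  _⪯_ : ℕ → ℕ → Set
  a ⪯ b = T (R a b)

  _≺_ : ℕ → ℕ → Set
  a ≺ b = a ⪯ b × a ≢ b

  record IsNPoset : Set where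
    field
      two≤n   : 2 ≤ n
      refl'   : ∀ a → a < n → a ⪯ a
      antisym : ∀ a b → a < n → b < n → a ⪯ b → b ⪯ a → a ≡ b
      trans'  : ∀ a b c → a < n → b < n → c < n → a ⪯ b → b ⪯ c → a ⪯ c
      least   : ∀ a → a < n → 0 ⪯ a
      greatest : ∀ a → a < n → a ⪯ 1

  IsJoin : ℕ → ℕ → ℕ → Set
  IsJoin a b c = c < n × a ⪯ c × b ⪯ c × (∀ d → d < n → a ⪯ d → b ⪯ d → c ⪯ d)

  IsMeet : ℕ → ℕ → ℕ → Set
  IsMeet a b c = c < n × c ⪯ a × c ⪯ b × (∀ d → d < n → d ⪯ a → d ⪯ b → d ⪯ c)

  IsNLattice : Set
  IsNLattice = IsNPoset × (∀ a b → a < n → b < n → (∃[ c ] IsJoin a b c) × (∃[ c ] IsMeet a b c))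

  Covers : ℕ → ℕ → Set
  Covers a b = a < n × b < n × a ≺ b × (∀ c → c < n → a ≺ c → c ≺ b → ⊥)

  data SChain : ℕ → ℕ → ℕ → Set where
    single : ∀ {a} → a < n → SChain a a 1
    step   : ∀ {a b c m} → a < n → a ≺ b → SChain b c m → SChain a c (suc m)

  Dep : ℕ → ℕ → Set
  Dep a p = SChain a 1 (suc p) × (∀ m → SChain a 1 m → m ≤ suc p)

  IsLevellised : Set
  IsLevellised = ∀ i j p q → 0 < i → i ≤ j → j < n → Dep i p → Dep j q → p ≤ q

  IsLevNLattice : Set
  IsLevNLattice = IsNLattice × IsLevellised

  CovD : ℕ → ℕ → ℕ → Set
  CovD i d j = Covers i j × Dep j d

  -- Truncation: k = dep_L(n-1), and the elements of depth ≠ k are exactly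
  -- the labels 0..n'-1, so that L' is the restriction of R to labels < n'.
  Trunc : ℕ → ℕ → Set
  Trunc k n' = Dep (n ∸ 1) k × (∀ i → i < n → (i < n' → ¬ Dep i k) × (¬ Dep i k → i < n'))

data WtIs (P : ℕ → Set) : ℕ → ℕ → Set where
  wt0   : WtIs P 0 0
  wtIn  : ∀ {m w} → P m → WtIs P m w → WtIs P (suc m) (2 ^ m + w)
  wtOut : ∀ {m w} → ¬ P m → WtIs P m w → WtIs P (suc m) w

EqOn : ℕ → Ord → Ord → Set
EqOn n R₁ R₂ = ∀ i j → i < n → j < n → R₁ i j ≡ R₂ i j

-- isomorphism as unlabelled posets (equivalently, lattices): a bijection
-- of {0..n-1} preserving and reflecting the order
Iso : ℕ → Ord → Ord → Set
Iso n R₁ R₂ = Σ (ℕ → ℕ) λ f → Σ (ℕ → ℕ) λ g →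
  (∀ i → i < n → f i < n) × (∀ i → i < n → g i < n) ×
  (∀ i → i < n → g (f i) ≡ i) × (∀ i → i < n → f (g i) ≡ i) ×
  (∀ i j → i < n → j < n → R₁ i j ≡ R₂ (f i) (f j))

SameWt : ℕ → Ord → Ord → ℕ → ℕ → Set
SameWt n R₁ R₂ d j = ∃[ w ] WtIs (CovD n R₁ j d) n w × WtIs (CovD n R₂ j d) n w

LessWt : ℕ → Ord → Ord → ℕ → ℕ → Set
LessWt n R₁ R₂ d j = ∃[ w₁ ] ∃[ w₂ ] WtIs (CovD n R₁ j d) n w₁ × WtIs (CovD n R₂ j d) n w₂ × w₁ < w₂

-- the second clause of the definition of <, with L₁' = L₂' on n' labels,
-- common k, last level {n', …, n-1}
LevelLess : ℕ → ℕ → ℕ → Ord → Ord → Set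
LevelLess n k n' R₁ R₂ =
  ∃[ ℓ ] ∃[ i ] 1 ≤ ℓ × ℓ < k × n' ≤ i × i < n ×
    (∀ d j → ℓ < d → d < k → n' ≤ j → j < n → SameWt n R₁ R₂ d j) ×
    (∀ j → n' ≤ j → j < i → SameWt n R₁ R₂ ℓ j) ×
    LessWt n R₁ R₂ ℓ i

-- The relation < by induction on n, with a fuel argument (fuel ≥ n
-- suffices since n' < n at each step; for n = 2 the relation is empty).
LessF : ℕ → ℕ → Ord → Ord → Set
LessF zero       n R₁ R₂ = ⊥
LessF (suc fuel) n R₁ R₂ = 2 < n ×
  ( (∃[ k₁ ] ∃[ k₂ ] ∃[ n' ] Trunc n R₁ k₁ n' × Trunc n R₂ k₂ n' × LessF fuel n' R₁ R₂)
  ⊎ (∃[ k ] ∃[ n' ] Trunc n R₁ k n' × Trunc n R₂ k n' × EqOn n' R₁ R₂ × LevelLess n k n' R₁ R₂))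

Less : ℕ → Ord → Ord → Set
Less n R₁ R₂ = LessF n n R₁ R₂

InClass : ℕ → Ord → Ord → Set
InClass n R₀ R = IsLevNLattice n R × Iso n R₀ R

module Submission where

-- Irreflexivity and transitivity hold for arbitrary orders.  The relation
-- recurses on the truncation L', which L determines uniquely (depth and
-- weight are unique), and its second clause is a lexicographic comparison
-- of the weights of the last level (largest depth first, then smallest
-- label), which is a strict order.
--
-- Trichotomy is the real content and is proved by induction on n.  Two
-- isomorphic levellised n-posets have the same depth k of their last label
-- and the same truncation point n', so their truncations are isomorphic
-- levellised n'-posets and the induction hypothesis compares them.  If the
-- truncations are equal, either a weight of the last level differs, and the
-- first difference decides, or all weights agree.  A weight determines the
-- set it is computed from (binary expansion), so then the last level has
-- the same covers in both orders, and these covers together with the common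
-- truncation determine the whole order: L₁ = L₂.

open import Defs
open import Data.Nat using (ℕ; zero; suc; _+_; _∸_; _^_; _≤_; _<_; z≤n; s≤s; _≟_; _≤?_; _<?_)
open import Data.Nat.Properties
open import Data.Nat.Induction using (<-wellFounded)
open import Induction.WellFounded using (Acc; acc)
open import Data.Bool using (Bool; true; false; T; T?)
open import Data.Product using (∃-syntax; _×_; _,_; proj₁; proj₂)
open import Data.Sum using (_⊎_; inj₁; inj₂; [_,_]′)
open import Data.Empty using (⊥-elim)
open import Data.Unit using (tt)
open import Data.Fin using (Fin; toℕ; fromℕ<)
open import Data.Fin.Properties using (injective⇒≤; toℕ-injective; toℕ<n; toℕ-fromℕ<)
open import Relation.Nullary using (¬_; Dec; yes; no; ¬?)
open import Relation.Nullary.Decidable using (_×-dec_; decidable-stable)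
open import Relation.Binary.PropositionalEquality
open import Relation.Binary.Definitions using (tri<; tri≈; tri>)

private
  variable
    m n n' n₁ n₂ k k₁ k₂ d a b c j p q w w₁ w₂ : ℕ
    R R' R₁ R₂ R₃ R₁' R₂' : Ord
    P Q : ℕ → Set

greatestBelow : (P : ℕ → Set) → (∀ x → Dec (P x)) → (N : ℕ) →
  (∃[ x ] x < N × P x × (∀ y → x < y → y < N → ¬ P y)) ⊎ (∀ x → x < N → ¬ P x)
greatestBelow P P? zero = inj₂ (λ _ ())
greatestBelow P P? (suc N) with P? N | greatestBelow P P? N
... | yes PN | _ = inj₁ (N , ≤-refl , PN , λ y N<y y<1+N _ → <-irrefl refl (<-≤-trans N<y (≤-pred y<1+N)))
... | no ¬PN | inj₁ (x , x<N , Px , above) =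
  inj₁ (x , m<n⇒m<1+n x<N , Px , λ y x<y y<1+N → [ above y x<y , (λ { refl → ¬PN }) ]′ (m<1+n⇒m<n∨m≡n y<1+N))
... | no ¬PN | inj₂ none =
  inj₂ λ x x<1+N → [ none x , (λ { refl → ¬PN }) ]′ (m<1+n⇒m<n∨m≡n x<1+N)

leastBelow : (P : ℕ → Set) → (∀ x → Dec (P x)) → (N : ℕ) →
  (∃[ x ] x < N × P x × (∀ y → y < x → ¬ P y)) ⊎ (∀ x → x < N → ¬ P x)
leastBelow P P? zero = inj₂ (λ _ ())
leastBelow P P? (suc N) with leastBelow P P? N | P? N
... | inj₁ (x , x<N , Px , below) | _ = inj₁ (x , m<n⇒m<1+n x<N , Px , below)
... | inj₂ none | yes PN = inj₁ (N , ≤-refl , PN , none)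
... | inj₂ none | no ¬PN =
  inj₂ λ x x<1+N → [ none x , (λ { refl → ¬PN }) ]′ (m<1+n⇒m<n∨m≡n x<1+N)

-- Weights

wt-unique : WtIs P m w₁ → WtIs P m w₂ → w₁ ≡ w₂
wt-unique wt0 wt0 = refl
wt-unique (wtIn _ W) (wtIn _ V) = cong (_ +_) (wt-unique W V)
wt-unique (wtIn p _) (wtOut ¬p _) = ⊥-elim (¬p p)
wt-unique (wtOut ¬p _) (wtIn p _) = ⊥-elim (¬p p)
wt-unique (wtOut _ W) (wtOut _ V) = wt-unique W V

wt-exists : (∀ x → Dec (P x)) → (m : ℕ) → ∃[ w ] WtIs P m w
wt-exists P? zero = 0 , wt0
wt-exists P? (suc m) with wt-exists P? m | P? m
... | _ , W | yes p = _ , wtIn p W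
... | _ , W | no ¬p = _ , wtOut ¬p W

wt-cong : (∀ j → j < m → (P j → Q j) × (Q j → P j)) → WtIs P m w → WtIs Q m w
wt-cong P⇔Q wt0 = wt0
wt-cong P⇔Q (wtIn p W) = wtIn (proj₁ (P⇔Q _ ≤-refl) p) (wt-cong (λ j j<m → P⇔Q j (m<n⇒m<1+n j<m)) W)
wt-cong P⇔Q (wtOut ¬p W) = wtOut (λ q → ¬p (proj₂ (P⇔Q _ ≤-refl) q)) (wt-cong (λ j j<m → P⇔Q j (m<n⇒m<1+n j<m)) W)

wt-bound : WtIs P m w → w < 2 ^ m
wt-bound wt0 = s≤s z≤n
wt-bound {m = suc m} (wtIn {w = w} _ W) = begin-strict
  2 ^ m + w        <⟨ +-monoʳ-< (2 ^ m) (wt-bound W) ⟩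
  2 ^ m + 2 ^ m    ≡⟨ cong (2 ^ m +_) (sym (+-identityʳ (2 ^ m))) ⟩
  2 ^ suc m        ∎
  where open ≤-Reasoning
wt-bound {m = suc m} (wtOut {w = w} _ W) = begin-strict
  w                <⟨ wt-bound W ⟩
  2 ^ m            ≤⟨ m≤m+n (2 ^ m) (2 ^ m + 0) ⟩
  2 ^ suc m        ∎
  where open ≤-Reasoning

-- Binary expansions are unique: a weight determines its subset.
wt-reflects : WtIs P m w₁ → WtIs Q m w₂ → w₁ ≡ w₂ → ∀ c → c < m → P c → Q c
wt-reflects wt0 wt0 _ c () _
wt-reflects {m = suc m} (wtIn _ W) (wtIn q V) e c c<1+m Pc with m<1+n⇒m<n∨m≡n c<1+m
... | inj₁ c<m = wt-reflects W V (+-cancelˡ-≡ (2 ^ m) _ _ e) c c<m Pc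
... | inj₂ refl = q
wt-reflects {m = suc m} (wtIn _ _) (wtOut _ V) e _ _ _ =
  ⊥-elim (<-irrefl refl (<-≤-trans (wt-bound V) (subst (2 ^ m ≤_) e (m≤m+n _ _))))
wt-reflects {m = suc m} (wtOut _ W) (wtIn _ _) e _ _ _ =
  ⊥-elim (<-irrefl refl (<-≤-trans (wt-bound W) (subst (2 ^ m ≤_) (sym e) (m≤m+n _ _))))
wt-reflects {m = suc m} (wtOut ¬p W) (wtOut _ V) e c c<1+m Pc with m<1+n⇒m<n∨m≡n c<1+m
... | inj₁ c<m = wt-reflects W V e c c<m Pc
... | inj₂ refl = ⊥-elim (¬p Pc)

-- All notions of Defs only inspect R on labels below n, so two orders that
-- agree there (EqOn n) have the same chains, depths, covers, weights,
-- truncations and comparisons.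

eqOn-sym : EqOn n R₁ R₂ → EqOn n R₂ R₁
eqOn-sym E i j i<n j<n = sym (E i j i<n j<n)

eqOn-trans : EqOn n R₁ R₂ → EqOn n R₂ R₃ → EqOn n R₁ R₃
eqOn-trans E F i j i<n j<n = trans (E i j i<n j<n) (F i j i<n j<n)

eqOn-restrict : n' ≤ n → EqOn n R₁ R₂ → EqOn n' R₁ R₂
eqOn-restrict n'≤n E i j i<n' j<n' = E i j (<-≤-trans i<n' n'≤n) (<-≤-trans j<n' n'≤n)

chain-start : SChain n R a c m → a < n
chain-start (single a<n) = a<n
chain-start (step a<n _ _) = a<n

≺-transport : EqOn n R R' → a < n → b < n → _≺_ n R a b → _≺_ n R' a b
≺-transport {a = a} {b} E a<n b<n (a⪯b , a≢b) = subst T (E a b a<n b<n) a⪯b , a≢b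

chain-transport : EqOn n R R' → SChain n R a c m → SChain n R' a c m
chain-transport E (single a<n) = single a<n
chain-transport E (step a<n a≺b ch) = step a<n (≺-transport E a<n (chain-start ch) a≺b) (chain-transport E ch)

dep-transport : EqOn n R R' → Dep n R a p → Dep n R' a p
dep-transport E (ch , longest) = chain-transport E ch , λ m ch' → longest m (chain-transport (eqOn-sym E) ch')

covers-transport : EqOn n R R' → Covers n R a b → Covers n R' a b
covers-transport E (a<n , b<n , a≺b , nothing-between) =
  a<n , b<n , ≺-transport E a<n b<n a≺b ,
  λ c c<n a≺c c≺b → nothing-between c c<n (≺-transport (eqOn-sym E) a<n c<n a≺c) (≺-transport (eqOn-sym E) c<n b<n c≺b)

wt-transport : EqOn n R R' → WtIs (CovD n R j d) n w → WtIs (CovD n R' j d) n w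
wt-transport E = wt-cong λ _ _ →
  (λ { (cov , D) → covers-transport E cov , dep-transport E D }) ,
  (λ { (cov , D) → covers-transport (eqOn-sym E) cov , dep-transport (eqOn-sym E) D })

trunc-transport : EqOn n R R' → Trunc n R k n' → Trunc n R' k n'
trunc-transport E (Dk , levels) = dep-transport E Dk , λ i i<n →
  (λ i<n' D → proj₁ (levels i i<n) i<n' (dep-transport (eqOn-sym E) D)) ,
  (λ ¬D → proj₂ (levels i i<n) (λ D → ¬D (dep-transport E D)))

sameWt-transport : EqOn n R₁ R₁' → EqOn n R₂ R₂' → SameWt n R₁ R₂ d j → SameWt n R₁' R₂' d j
sameWt-transport E₁ E₂ (w , W₁ , W₂) = w , wt-transport E₁ W₁ , wt-transport E₂ W₂

levelLess-transport : EqOn n R₁ R₁' → EqOn n R₂ R₂' → LevelLess n k n' R₁ R₂ → LevelLess n k n' R₁' R₂'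
levelLess-transport E₁ E₂ (ℓ , i , 1≤ℓ , ℓ<k , n'≤i , i<n , above , before , (w₁ , w₂ , W₁ , W₂ , w₁<w₂)) =
  ℓ , i , 1≤ℓ , ℓ<k , n'≤i , i<n ,
  (λ d j ℓ<d d<k n'≤j j<n → sameWt-transport E₁ E₂ (above d j ℓ<d d<k n'≤j j<n)) ,
  (λ j n'≤j j<i → sameWt-transport E₁ E₂ (before j n'≤j j<i)) ,
  (w₁ , w₂ , wt-transport E₁ W₁ , wt-transport E₂ W₂ , w₁<w₂)

last<n : 1 ≤ n → n ∸ 1 < n
last<n {suc n} _ = ≤-refl

≤last : a < n → a ≤ n ∸ 1
≤last {n = suc n} (s≤s a≤n) = a≤n

last≢0 : 3 ≤ n → n ∸ 1 ≢ 0
last≢0 (s≤s (s≤s (s≤s _))) ()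

3≤3+ : 3 ≤ 3 + m
3≤3+ = s≤s (s≤s (s≤s z≤n))

2<⇒1≤ : 2 < n → 1 ≤ n
2<⇒1≤ 2<n = ≤-trans (s≤s z≤n) 2<n

-- The truncation point lies strictly below n, since the label n-1 has
-- depth k.
trunc-bound : 1 ≤ n → Trunc n R k n' → n' < n
trunc-bound {n} {n' = n'} 1≤n (Dk , levels) with n ≤? n'
... | no n≰n' = ≰⇒> n≰n'
... | yes n≤n' = ⊥-elim (proj₁ (levels (n ∸ 1) n-1<n) (<-≤-trans n-1<n n≤n') Dk)
  where n-1<n = last<n 1≤n

lessF-transport : ∀ fuel → EqOn n R₁ R₁' → EqOn n R₂ R₂' → LessF fuel n R₁ R₂ → LessF fuel n R₁' R₂'
lessF-transport (suc fuel) E₁ E₂ (2<n , inj₁ (k₁ , k₂ , n' , T₁ , T₂ , L')) =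
  2<n , inj₁ (k₁ , k₂ , n' , trunc-transport E₁ T₁ , trunc-transport E₂ T₂ ,
              lessF-transport fuel (eqOn-restrict n'≤n E₁) (eqOn-restrict n'≤n E₂) L')
  where n'≤n = <⇒≤ (trunc-bound (2<⇒1≤ 2<n) T₁)
lessF-transport (suc fuel) E₁ E₂ (2<n , inj₂ (k , n' , T₁ , T₂ , E , LL)) =
  2<n , inj₂ (k , n' , trunc-transport E₁ T₁ , trunc-transport E₂ T₂ ,
              eqOn-trans (eqOn-sym (eqOn-restrict n'≤n E₁)) (eqOn-trans E (eqOn-restrict n'≤n E₂)) ,
              levelLess-transport E₁ E₂ LL)
  where n'≤n = <⇒≤ (trunc-bound (2<⇒1≤ 2<n) T₁)

dep-unique : Dep n R a p → Dep n R a q → p ≡ q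
dep-unique (ch₁ , longest₁) (ch₂ , longest₂) = suc-injective (≤-antisym (longest₂ _ ch₁) (longest₁ _ ch₂))

trunc-point-≤ : 1 ≤ n → Trunc n R k n₁ → Trunc n R k n₂ → n₁ ≤ n₂
trunc-point-≤ {n₁ = n₁} {n₂ = n₂} 1≤n (_ , levels₁) T₂@(_ , levels₂) with n₁ ≤? n₂
... | yes n₁≤n₂ = n₁≤n₂
... | no n₁≰n₂ = ⊥-elim (<-irrefl refl (proj₂ (levels₂ n₂ n₂<n) (proj₁ (levels₁ n₂ n₂<n) n₂<n₁)))
  where
    n₂<n₁ = ≰⇒> n₁≰n₂
    n₂<n = trunc-bound 1≤n T₂

trunc-unique : 1 ≤ n → Trunc n R k₁ n₁ → Trunc n R k₂ n₂ → k₁ ≡ k₂ × n₁ ≡ n₂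
trunc-unique 1≤n T₁ T₂ with dep-unique (proj₁ T₁) (proj₁ T₂)
... | refl = refl , ≤-antisym (trunc-point-≤ 1≤n T₁ T₂) (trunc-point-≤ 1≤n T₂ T₁)

lessF-irrefl : ∀ fuel → ¬ LessF fuel n R R
lessF-irrefl (suc fuel) (_ , inj₁ (_ , _ , _ , _ , _ , L')) = lessF-irrefl fuel L'
lessF-irrefl (suc fuel) (_ , inj₂ (_ , _ , _ , _ , _ , (_ , _ , _ , _ , _ , _ , _ , _ , (_ , _ , W₁ , W₂ , w₁<w₂)))) =
  <-irrefl (wt-unique W₁ W₂) w₁<w₂

sameWt-trans : SameWt n R₁ R₂ d j → SameWt n R₂ R₃ d j → SameWt n R₁ R₃ d j
sameWt-trans (w , W₁ , W₂) (_ , W₂' , W₃) = w , W₁ , subst (WtIs _ _) (wt-unique W₂' W₂) W₃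

lessWt-sameWt : LessWt n R₁ R₂ d j → SameWt n R₂ R₃ d j → LessWt n R₁ R₃ d j
lessWt-sameWt (w₁ , _ , W₁ , W₂ , w₁<w₂) (w , W₂' , W₃) = w₁ , w , W₁ , W₃ , subst (w₁ <_) (wt-unique W₂ W₂') w₁<w₂

sameWt-lessWt : SameWt n R₁ R₂ d j → LessWt n R₂ R₃ d j → LessWt n R₁ R₃ d j
sameWt-lessWt (w , W₁ , W₂) (_ , w₃ , W₂' , W₃ , w₂<w₃) = w , w₃ , W₁ , W₃ , subst (_< w₃) (wt-unique W₂' W₂) w₂<w₃

lessWt-trans : LessWt n R₁ R₂ d j → LessWt n R₂ R₃ d j → LessWt n R₁ R₃ d j
lessWt-trans (w₁ , w₂ , W₁ , W₂ , w₁<w₂) (_ , w₃ , W₂' , W₃ , w₂'<w₃) =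
  w₁ , w₃ , W₁ , W₃ , <-trans w₁<w₂ (subst (_< w₃) (wt-unique W₂' W₂) w₂'<w₃)

-- The lexicographic comparison is transitive: the first difference of the
-- composite is the earlier of the two first differences.
levelLess-trans : LevelLess n k n' R₁ R₂ → LevelLess n k n' R₂ R₃ → LevelLess n k n' R₁ R₃
levelLess-trans (ℓ , i , 1≤ℓ , ℓ<k , n'≤i , i<n , above , before , less)
                (ℓ' , i' , 1≤ℓ' , ℓ'<k , n'≤i' , i'<n , above' , before' , less') with <-cmp ℓ ℓ'
... | tri< ℓ<ℓ' _ _ = ℓ' , i' , 1≤ℓ' , ℓ'<k , n'≤i' , i'<n ,
  (λ d j ℓ'<d d<k n'≤j j<n → sameWt-trans (above d j (<-trans ℓ<ℓ' ℓ'<d) d<k n'≤j j<n) (above' d j ℓ'<d d<k n'≤j j<n)) ,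
  (λ j n'≤j j<i' → sameWt-trans (above ℓ' j ℓ<ℓ' ℓ'<k n'≤j (<-trans j<i' i'<n)) (before' j n'≤j j<i')) ,
  sameWt-lessWt (above ℓ' i' ℓ<ℓ' ℓ'<k n'≤i' i'<n) less'
... | tri> _ _ ℓ'<ℓ = ℓ , i , 1≤ℓ , ℓ<k , n'≤i , i<n ,
  (λ d j ℓ<d d<k n'≤j j<n → sameWt-trans (above d j ℓ<d d<k n'≤j j<n) (above' d j (<-trans ℓ'<ℓ ℓ<d) d<k n'≤j j<n)) ,
  (λ j n'≤j j<i → sameWt-trans (before j n'≤j j<i) (above' ℓ j ℓ'<ℓ ℓ<k n'≤j (<-trans j<i i<n))) ,
  lessWt-sameWt less (above' ℓ i ℓ'<ℓ ℓ<k n'≤i i<n)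
... | tri≈ _ refl _ with <-cmp i i'
...   | tri< i<i' _ _ = ℓ , i , 1≤ℓ , ℓ<k , n'≤i , i<n ,
  (λ d j ℓ<d d<k n'≤j j<n → sameWt-trans (above d j ℓ<d d<k n'≤j j<n) (above' d j ℓ<d d<k n'≤j j<n)) ,
  (λ j n'≤j j<i → sameWt-trans (before j n'≤j j<i) (before' j n'≤j (<-trans j<i i<i'))) ,
  lessWt-sameWt less (before' i n'≤i i<i')
...   | tri≈ _ refl _ = ℓ , i , 1≤ℓ , ℓ<k , n'≤i , i<n ,
  (λ d j ℓ<d d<k n'≤j j<n → sameWt-trans (above d j ℓ<d d<k n'≤j j<n) (above' d j ℓ<d d<k n'≤j j<n)) ,
  (λ j n'≤j j<i → sameWt-trans (before j n'≤j j<i) (before' j n'≤j j<i)) ,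
  lessWt-trans less less'
...   | tri> _ _ i'<i = ℓ , i' , 1≤ℓ , ℓ<k , n'≤i' , i'<n ,
  (λ d j ℓ<d d<k n'≤j j<n → sameWt-trans (above d j ℓ<d d<k n'≤j j<n) (above' d j ℓ<d d<k n'≤j j<n)) ,
  (λ j n'≤j j<i' → sameWt-trans (before j n'≤j (<-trans j<i' i'<i)) (before' j n'≤j j<i')) ,
  sameWt-lessWt (before i' n'≤i' i'<i) less'

-- Transitivity of < for arbitrary orders.  Both comparisons truncate the
-- middle order R₂ at the same point, so in each combination of clauses the
-- truncated comparisons compose.
lessF-trans : ∀ fuel → LessF fuel n R₁ R₂ → LessF fuel n R₂ R₃ → LessF fuel n R₁ R₃
lessF-trans (suc fuel) (2<n , inj₁ (k₁ , _ , n' , T₁ , T₂ , L₁₂)) (_ , inj₁ (_ , k₃ , _ , T₂' , T₃ , L₂₃))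
  with trunc-unique (2<⇒1≤ 2<n) T₂ T₂'
... | refl , refl = 2<n , inj₁ (k₁ , k₃ , n' , T₁ , T₃ , lessF-trans fuel L₁₂ L₂₃)
lessF-trans (suc fuel) (2<n , inj₁ (k₁ , _ , n' , T₁ , T₂ , L₁₂)) (_ , inj₂ (k , _ , T₂' , T₃ , E₂₃ , _))
  with trunc-unique (2<⇒1≤ 2<n) T₂ T₂'
... | refl , refl = 2<n , inj₁ (k₁ , k , n' , T₁ , T₃ , lessF-transport fuel (λ _ _ _ _ → refl) E₂₃ L₁₂)
lessF-trans (suc fuel) (2<n , inj₂ (k , n' , T₁ , T₂ , E₁₂ , _)) (_ , inj₁ (_ , k₃ , _ , T₂' , T₃ , L₂₃))
  with trunc-unique (2<⇒1≤ 2<n) T₂ T₂'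
... | refl , refl = 2<n , inj₁ (k , k₃ , n' , T₁ , T₃ , lessF-transport fuel (eqOn-sym E₁₂) (λ _ _ _ _ → refl) L₂₃)
lessF-trans (suc fuel) (2<n , inj₂ (k , n' , T₁ , T₂ , E₁₂ , LL₁₂)) (_ , inj₂ (_ , _ , T₂' , T₃ , E₂₃ , LL₂₃))
  with trunc-unique (2<⇒1≤ 2<n) T₂ T₂'
... | refl , refl = 2<n , inj₂ (k , n' , T₁ , T₃ , eqOn-trans E₁₂ E₂₃ , levelLess-trans LL₁₂ LL₂₃)

indicator : Bool → ℕ
indicator true = 1
indicator false = 0

indicator-≤1 : ∀ x → indicator x ≤ 1
indicator-≤1 true = ≤-refl
indicator-≤1 false = z≤n

indicator-mono : ∀ x y → (T x → T y) → indicator x ≤ indicator y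
indicator-mono false y x⇒y = z≤n
indicator-mono true true x⇒y = ≤-refl
indicator-mono true false x⇒y = ⊥-elim (x⇒y tt)

indicator-strict : ∀ x y → ¬ T x → T y → indicator x < indicator y
indicator-strict true y ¬x _ = ⊥-elim (¬x tt)
indicator-strict false true _ _ = ≤-refl

countTrue : (ℕ → Bool) → ℕ → ℕ
countTrue f zero = 0
countTrue f (suc N) = indicator (f N) + countTrue f N

countTrue-≤ : ∀ f N → countTrue f N ≤ N
countTrue-≤ f zero = z≤n
countTrue-≤ f (suc N) = +-mono-≤ (indicator-≤1 (f N)) (countTrue-≤ f N)

countTrue-mono : ∀ f g N → (∀ x → x < N → T (f x) → T (g x)) → countTrue f N ≤ countTrue g N
countTrue-mono f g zero f⊆g = z≤n
countTrue-mono f g (suc N) f⊆g =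
  +-mono-≤ (indicator-mono (f N) (g N) (f⊆g N ≤-refl)) (countTrue-mono f g N λ x x<N → f⊆g x (m<n⇒m<1+n x<N))

countTrue-strict : ∀ f g N → (∀ x → x < N → T (f x) → T (g x)) →
  ∀ x₀ → x₀ < N → ¬ T (f x₀) → T (g x₀) → countTrue f N < countTrue g N
countTrue-strict f g (suc N) f⊆g x₀ x₀<1+N ¬fx₀ gx₀ with m<1+n⇒m<n∨m≡n x₀<1+N
... | inj₂ refl = +-mono-<-≤ (indicator-strict (f N) (g N) ¬fx₀ gx₀) (countTrue-mono f g N f⊆g<N)
  where f⊆g<N = λ x x<N → f⊆g x (m<n⇒m<1+n x<N)
... | inj₁ x₀<N = +-mono-≤-< (indicator-mono (f N) (g N) (f⊆g N ≤-refl)) (countTrue-strict f g N f⊆g<N x₀ x₀<N ¬fx₀ gx₀)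
  where f⊆g<N = λ x x<N → f⊆g x (m<n⇒m<1+n x<N)

injection-≤ : ∀ A B (h : ℕ → ℕ) → (∀ x → x < A → h x < B) →
  (∀ x y → x < A → y < A → h x ≡ h y → x ≡ y) → A ≤ B
injection-≤ A B h h< h-inj = injective⇒≤ {f = h'} h'-inj
  where
    h' : Fin A → Fin B
    h' x = fromℕ< (h< (toℕ x) (toℕ<n x))
    h'-inj : ∀ {x y} → h' x ≡ h' y → x ≡ y
    h'-inj {x} {y} e = toℕ-injective (h-inj _ _ (toℕ<n x) (toℕ<n y) (begin
      h (toℕ x)   ≡⟨ toℕ-fromℕ< (h< (toℕ x) (toℕ<n x)) ⟨
      toℕ (h' x)  ≡⟨ cong toℕ e ⟩
      toℕ (h' y)  ≡⟨ toℕ-fromℕ< (h< (toℕ y) (toℕ<n y)) ⟩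
      h (toℕ y)   ∎))
      where open ≡-Reasoning

-- Chains, depth and covers in an n-poset

chain-end : SChain n R a c m → c < n
chain-end (single c<n) = c<n
chain-end (step _ _ ch) = chain-end ch

module Poset (n : ℕ) (R : Ord) (po : IsNPoset n R) where
  open IsNPoset po

  1<n : 1 < n
  1<n = two≤n

  0<n : 0 < n
  0<n = <-trans (s≤s z≤n) two≤n

  _≺?_ : ∀ a b → Dec (_≺_ n R a b)
  a ≺? b with T? (R a b) | a ≟ b
  ... | yes a⪯b | no a≢b = yes (a⪯b , a≢b)
  ... | yes _ | yes a≡b = no λ a≺b → proj₂ a≺b a≡b
  ... | no a⋠b | _ = no λ a≺b → a⋠b (proj₁ a≺b)

  -- The number of elements above a; it strictly decreases along ≺ and so
  -- bounds the length of chains.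
  up : ℕ → ℕ
  up a = countTrue (R a) n

  up-decreasing : a < n → b < n → _≺_ n R a b → up b < up a
  up-decreasing {a} {b} a<n b<n (a⪯b , a≢b) =
    countTrue-strict (R b) (R a) n (λ x x<n b⪯x → trans' a b x a<n b<n x<n a⪯b b⪯x) a a<n
      (λ b⪯a → a≢b (antisym a b a<n b<n a⪯b b⪯a)) (refl' a a<n)

  down : ℕ → ℕ
  down b = countTrue (λ x → R x b) n

  down-increasing : a < n → b < n → _≺_ n R a b → down a < down b
  down-increasing {a} {b} a<n b<n (a⪯b , a≢b) =
    countTrue-strict (λ x → R x a) (λ x → R x b) n (λ x x<n x⪯a → trans' x a b x<n a<n b<n x⪯a a⪯b) b b<n
      (λ b⪯a → a≢b (antisym a b a<n b<n a⪯b b⪯a)) (refl' b b<n)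

  up-pos : a < n → 1 ≤ up a
  up-pos {a} a<n = ≤-trans (s≤s z≤n) (countTrue-strict (λ _ → false) (R a) n (λ _ _ ()) a a<n (λ ()) (refl' a a<n))

  chain-≤ : SChain n R a c m → T (R a c)
  chain-≤ (single a<n) = refl' _ a<n
  chain-≤ (step a<n a≺b ch) = trans' _ _ _ a<n (chain-start ch) (chain-end ch) (proj₁ a≺b) (chain-≤ ch)

  chain-length-bound : SChain n R a c m → m ≤ up a
  chain-length-bound (single a<n) = up-pos a<n
  chain-length-bound (step a<n a≺b ch) = ≤-trans (s≤s (chain-length-bound ch)) (up-decreasing a<n (chain-start ch) a≺b)

  chain? : ∀ m a → Dec (SChain n R a 1 m)
  chain? zero a = no λ ()
  chain? (suc zero) a with a ≟ 1 | a <? n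
  ... | yes refl | yes a<n = yes (single a<n)
  ... | yes refl | no a≮n = no λ { (single a<n) → a≮n a<n ; (step _ _ ()) }
  ... | no a≢1 | _ = no λ { (single _) → a≢1 refl ; (step _ _ ()) }
  chain? (suc (suc m)) a with a <? n | anyUpTo? (λ b → (a ≺? b) ×-dec chain? (suc m) b) n
  ... | no a≮n | _ = no λ { (step a<n _ _) → a≮n a<n }
  ... | yes a<n | yes (b , _ , a≺b , ch) = yes (step a<n a≺b ch)
  ... | yes a<n | no none = no λ { (step _ a≺b ch) → none (_ , chain-start ch , a≺b , ch) }

  -- Every element has a depth: chains from a to 1 exist (a ⪯ 1) and have
  -- bounded length, so take the longest one.
  depth-exists : a < n → ∃[ p ] Dep n R a p
  depth-exists {a} a<n with greatestBelow (λ m → SChain n R a 1 m) (λ m → chain? m a) (suc n)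
  ... | inj₂ none = ⊥-elim (none (proj₁ to1) (s≤s (proj₁ (proj₂ to1))) (proj₂ (proj₂ to1)))
    where
      to1 : ∃[ m ] m ≤ n × SChain n R a 1 m
      to1 with a ≟ 1
      ... | yes refl = 1 , <⇒≤ 1<n , single a<n
      ... | no a≢1 = 2 , two≤n , step a<n (greatest a a<n , a≢1) (single 1<n)
  ... | inj₁ (suc p , _ , ch , longest) = p , ch , λ m ch' → ≮⇒≥ λ p<m →
          longest m p<m (s≤s (≤-trans (chain-length-bound ch') (countTrue-≤ (R a) n))) ch'

  depth : ∀ a → a < n → ℕ
  depth a a<n = proj₁ (depth-exists a<n)

  depth-spec : (a<n : a < n) → Dep n R a (depth a a<n)
  depth-spec a<n = proj₂ (depth-exists a<n)

  dep? : ∀ a d → Dec (Dep n R a d)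
  dep? a d with a <? n
  ... | no a≮n = no λ D → a≮n (chain-start (proj₁ D))
  ... | yes a<n with d ≟ depth a a<n
  ...   | yes refl = yes (depth-spec a<n)
  ...   | no d≢p = no λ D → d≢p (dep-unique D (depth-spec a<n))

  dep-decreasing : a < n → _≺_ n R a b → Dep n R a p → Dep n R b q → q < p
  dep-decreasing a<n a≺b (_ , longest) (ch , _) = ≤-pred (longest _ (step a<n a≺b ch))

  dep-top : Dep n R 1 0
  dep-top = single 1<n , longest
    where
      longest : ∀ m → SChain n R 1 1 m → m ≤ 1
      longest m (single _) = ≤-refl
      longest m (step _ (1⪯b , 1≢b) ch) = ⊥-elim (1≢b (antisym 1 _ 1<n (chain-start ch) 1⪯b (chain-≤ ch)))

  dep-zero : Dep n R a 0 → a ≡ 1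
  dep-zero (single _ , _) = refl
  dep-zero (step _ _ () , _)

  -- With at least three elements the last label n-1 is neither 0 nor 1,
  -- so its depth is positive.
  last-depth-pos : 3 ≤ n → Dep n R (n ∸ 1) k → 1 ≤ k
  last-depth-pos {k = suc k} _ _ = s≤s z≤n
  last-depth-pos {k = zero} (s≤s (s≤s (s≤s _))) D with dep-zero D
  ... | ()

  covers? : ∀ a b → Dec (Covers n R a b)
  covers? a b with a <? n | b <? n | a ≺? b | anyUpTo? (λ c → (a ≺? c) ×-dec (c ≺? b)) n
  ... | no a≮n | _ | _ | _ = no λ cov → a≮n (proj₁ cov)
  ... | yes _ | no b≮n | _ | _ = no λ cov → b≮n (proj₁ (proj₂ cov))
  ... | yes _ | yes _ | no a⊀b | _ = no λ cov → a⊀b (proj₁ (proj₂ (proj₂ cov)))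
  ... | yes _ | yes _ | yes _ | yes (c , c<n , a≺c , c≺b) = no λ cov → proj₂ (proj₂ (proj₂ cov)) c c<n a≺c c≺b
  ... | yes a<n | yes b<n | yes a≺b | no none = yes (a<n , b<n , a≺b , λ c c<n a≺c c≺b → none (c , c<n , a≺c , c≺b))

  cover-below : a < n → b < n → _≺_ n R a b → ∃[ c ] Covers n R a c × T (R c b)
  cover-below a<n b<n = search a<n b<n (<-wellFounded _)
    where
      search : a < n → b < n → Acc _<_ (down b) → _≺_ n R a b → ∃[ c ] Covers n R a c × T (R c b)
      search {a} {b} a<n b<n (acc smaller) a≺b with anyUpTo? (λ c → (a ≺? c) ×-dec (c ≺? b)) n
      ... | no none = b , (a<n , b<n , a≺b , λ c c<n a≺c c≺b → none (c , c<n , a≺c , c≺b)) , refl' b b<n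
      ... | yes (c , c<n , a≺c , c≺b) with search a<n c<n (smaller (down-increasing c<n b<n c≺b)) a≺c
      ...   | c' , cov , c'⪯c = c' , cov , trans' c' c b (proj₁ (proj₂ cov)) c<n b<n c'⪯c (proj₁ c≺b)

  weight : ℕ → ℕ → ℕ
  weight d j = proj₁ (wt-exists (λ c → covers? j c ×-dec dep? c d) n)

  weight-spec : ∀ d j → WtIs (CovD n R j d) n (weight d j)
  weight-spec d j = proj₂ (wt-exists (λ c → covers? j c ×-dec dep? c d) n)

  covers-top⇒depth-one : Covers n R a 1 → Dep n R a p → p ≡ 1
  covers-top⇒depth-one (_ , _ , (_ , a≢1) , _) (single _ , _) = ⊥-elim (a≢1 refl)
  covers-top⇒depth-one _ (step _ _ (single _) , _) = refl
  covers-top⇒depth-one (_ , _ , _ , nothing-between) (step _ a≺b (step b<n b≺c ch) , _) =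
    ⊥-elim (nothing-between _ b<n a≺b (greatest _ b<n , b≢1))
    where
      b≢1 : _ ≢ 1
      b≢1 refl = proj₂ b≺c (antisym 1 _ 1<n (chain-start ch) (proj₁ b≺c) (greatest _ (chain-start ch)))

  depth-one⇒covers-top : a < n → Dep n R a 1 → Covers n R a 1
  depth-one⇒covers-top {a} a<n D@(_ , longest) = a<n , 1<n , (greatest a a<n , a≢1) ,
    λ c c<n a≺c c≺1 → <-irrefl refl (longest 3 (step a<n a≺c (step c<n c≺1 (single 1<n))))
    where
      a≢1 : a ≢ 1
      a≢1 refl with dep-unique D dep-top
      ... | ()

-- Isomorphisms

-- The inverse isomorphism; its maps are definitionally those of the given
-- one swapped (Σ has η), so facts about both maps can be combined.
iso-sym : Iso n R₁ R₂ → Iso n R₂ R₁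
iso-sym {R₂ = R₂} (f , g , f< , g< , gf , fg , pres) = g , f , g< , f< , fg , gf ,
  λ i j i<n j<n → trans (cong₂ R₂ (sym (fg i i<n)) (sym (fg j j<n))) (sym (pres (g i) (g j) (g< i i<n) (g< j j<n)))

iso-trans : Iso n R₁ R₂ → Iso n R₂ R₃ → Iso n R₁ R₃
iso-trans (f₁ , g₁ , f₁< , g₁< , g₁f₁ , f₁g₁ , pres₁) (f₂ , g₂ , f₂< , g₂< , g₂f₂ , f₂g₂ , pres₂) =
  (λ i → f₂ (f₁ i)) , (λ i → g₁ (g₂ i)) , (λ i i<n → f₂< _ (f₁< i i<n)) , (λ i i<n → g₁< _ (g₂< i i<n)) ,
  (λ i i<n → trans (cong g₁ (g₂f₂ (f₁ i) (f₁< i i<n))) (g₁f₁ i i<n)) ,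
  (λ i i<n → trans (cong f₂ (f₁g₁ (g₂ i) (g₂< i i<n))) (f₂g₂ i i<n)) ,
  (λ i j i<n j<n → trans (pres₁ i j i<n j<n) (pres₂ (f₁ i) (f₁ j) (f₁< i i<n) (f₁< j j<n)))

module IsoMap (n : ℕ) (R₁ R₂ : Ord) (po₁ : IsNPoset n R₁) (po₂ : IsNPoset n R₂) (iso : Iso n R₁ R₂) where
  private
    module P₁ = IsNPoset po₁
    module P₂ = IsNPoset po₂

  f g : ℕ → ℕ
  f = proj₁ iso
  g = proj₁ (proj₂ iso)

  f< : a < n → f a < n
  f< = proj₁ (proj₂ (proj₂ iso)) _

  g< : a < n → g a < n
  g< = proj₁ (proj₂ (proj₂ (proj₂ iso))) _

  gf : a < n → g (f a) ≡ a
  gf = proj₁ (proj₂ (proj₂ (proj₂ (proj₂ iso)))) _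

  fg : a < n → f (g a) ≡ a
  fg = proj₁ (proj₂ (proj₂ (proj₂ (proj₂ (proj₂ iso))))) _

  f-pres : a < n → b < n → R₁ a b ≡ R₂ (f a) (f b)
  f-pres = proj₂ (proj₂ (proj₂ (proj₂ (proj₂ (proj₂ iso))))) _ _

  f-injective : a < n → b < n → f a ≡ f b → a ≡ b
  f-injective a<n b<n fa≡fb = trans (sym (gf a<n)) (trans (cong g fa≡fb) (gf b<n))

  f-chain : SChain n R₁ a c m → SChain n R₂ (f a) (f c) m
  f-chain (single a<n) = single (f< a<n)
  f-chain (step a<n (a⪯b , a≢b) ch) =
    step (f< a<n) (subst T (f-pres a<n b<n) a⪯b , λ fa≡fb → a≢b (f-injective a<n b<n fa≡fb)) (f-chain ch)
    where b<n = chain-start ch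

  f-top : f 1 ≡ 1
  f-top = P₂.antisym (f 1) 1 (f< 1<n) 1<n (P₂.greatest (f 1) (f< 1<n)) 1⪯f1
    where
      1<n = P₁.two≤n
      1⪯f1 : T (R₂ 1 (f 1))
      1⪯f1 = subst (λ x → T (R₂ x (f 1))) (fg 1<n) (subst T (f-pres (g< 1<n) 1<n) (P₁.greatest (g 1) (g< 1<n)))

  f-bottom : f 0 ≡ 0
  f-bottom = P₂.antisym (f 0) 0 (f< 0<n) 0<n f0⪯0 (P₂.least (f 0) (f< 0<n))
    where
      0<n = Poset.0<n n R₁ po₁
      f0⪯0 : T (R₂ (f 0) 0)
      f0⪯0 = subst (λ x → T (R₂ (f 0) x)) (fg 0<n) (subst T (f-pres 0<n (g< 0<n)) (P₁.least (g 0) (g< 0<n)))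

module Isomorphism (n : ℕ) (R₁ R₂ : Ord) (po₁ : IsNPoset n R₁) (po₂ : IsNPoset n R₂) (iso : Iso n R₁ R₂) where
  open IsoMap n R₁ R₂ po₁ po₂ iso public
  private
    module Inv = IsoMap n R₂ R₁ po₂ po₁ (iso-sym iso)

  dep-backward : a < n → Dep n R₂ (f a) p → Dep n R₁ a p
  dep-backward {a} {p} a<n (ch' , longest) =
    subst₂ (λ u v → SChain n R₁ u v (suc p)) (gf a<n) Inv.f-top (Inv.f-chain ch') ,
    λ m ch → longest m (subst (λ y → SChain n R₂ (f a) y m) f-top (f-chain ch))

  -- In a levellised n-poset, n-1 has the largest depth among the nonzero
  -- elements; its preimage g(n-1) is nonzero, which bounds the depth of
  -- n-1 in R₂.
  last-depth-≤ : 3 ≤ n → IsLevellised n R₁ → Dep n R₁ (n ∸ 1) k₁ → Dep n R₂ (n ∸ 1) k₂ → k₂ ≤ k₁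
  last-depth-≤ 3≤n lev₁ D₁ D₂ = lev₁ x (n ∸ 1) _ _ 0<x (≤last x<n) last D-x D₁
    where
      last = last<n (2<⇒1≤ 3≤n)
      x = g (n ∸ 1)
      x<n = g< last
      D-x = dep-backward x<n (subst (λ y → Dep n R₂ y _) (sym (fg last)) D₂)
      0<x : 0 < x
      0<x = n≢0⇒n>0 λ x≡0 → last≢0 3≤n (trans (sym (fg last)) (trans (cong f x≡0) f-bottom))

  -- f maps the truncation of R₁ into that of R₂ (depth ≠ k is preserved),
  -- so truncation points can only grow along an isomorphism.
  truncation-maps : Trunc n R₁ k n₁ → Trunc n R₂ k n₂ → a < n₁ → f a < n₂
  truncation-maps T₁ T₂ a<n₁ = proj₂ (proj₂ T₂ _ (f< a<n)) λ D → proj₁ (proj₂ T₁ _ a<n) a<n₁ (dep-backward a<n D)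
    where a<n = <-trans a<n₁ (trunc-bound (<⇒≤ (Poset.1<n n R₁ po₁)) T₁)

  truncation-point-≤ : Trunc n R₁ k n₁ → Trunc n R₂ k n₂ → n₁ ≤ n₂
  truncation-point-≤ T₁ T₂ = injection-≤ _ _ f (λ _ → truncation-maps T₁ T₂)
    λ x y x<n₁ y<n₁ → f-injective (<-trans x<n₁ n₁<n) (<-trans y<n₁ n₁<n)
    where n₁<n = trunc-bound (<⇒≤ (Poset.1<n n R₁ po₁)) T₁

iso-same-truncation : (po₁ : IsNPoset n R₁) (po₂ : IsNPoset n R₂) → IsLevellised n R₁ → IsLevellised n R₂ →
  3 ≤ n → Iso n R₁ R₂ → Trunc n R₁ k₁ n₁ → Trunc n R₂ k₂ n₂ → k₁ ≡ k₂ × n₁ ≡ n₂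
iso-same-truncation {n} {R₁} {R₂} {n₂ = n₂} po₁ po₂ lev₁ lev₂ 3≤n iso T₁ T₂ =
  k₁≡k₂ , ≤-antisym (I.truncation-point-≤ T₁ T₂') (Inv.truncation-point-≤ T₂' T₁)
  where
    module I = Isomorphism n R₁ R₂ po₁ po₂ iso
    module Inv = Isomorphism n R₂ R₁ po₂ po₁ (iso-sym iso)
    k₁≡k₂ = ≤-antisym (Inv.last-depth-≤ 3≤n lev₂ (proj₁ T₂) (proj₁ T₁)) (I.last-depth-≤ 3≤n lev₁ (proj₁ T₁) (proj₁ T₂))
    T₂' = subst (λ k → Trunc n R₂ k n₂) (sym k₁≡k₂) T₂

iso-restrict : (po₁ : IsNPoset n R₁) (po₂ : IsNPoset n R₂) → Iso n R₁ R₂ →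
  Trunc n R₁ k n' → Trunc n R₂ k n' → Iso n' R₁ R₂
iso-restrict {n} {R₁} {R₂} po₁ po₂ iso T₁ T₂ =
  I.f , I.g , (λ _ → I.truncation-maps T₁ T₂) , (λ _ → Inv.truncation-maps T₂ T₁) ,
  (λ _ a<n' → I.gf (<-trans a<n' n'<n)) , (λ _ a<n' → I.fg (<-trans a<n' n'<n)) ,
  λ _ _ a<n' b<n' → I.f-pres (<-trans a<n' n'<n) (<-trans b<n' n'<n)
  where
    module I = Isomorphism n R₁ R₂ po₁ po₂ iso
    module Inv = Isomorphism n R₂ R₁ po₂ po₁ (iso-sym iso)
    n'<n = trunc-bound (<⇒≤ (Poset.1<n n R₁ po₁)) T₁

-- Truncation of a levellised n-poset

-- Every levellised n-poset with n ≥ 3 has a truncation: with lastDepth the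
-- depth of n-1, the labels of that depth form a final segment
-- {n', …, n-1}, where n' is the least nonzero label of depth lastDepth
-- (0 lies strictly below n-1, so its depth is larger).
module Levellised (n : ℕ) (R : Ord) (po : IsNPoset n R) (lev : IsLevellised n R) (3≤n : 3 ≤ n) where
  open IsNPoset po
  open Poset n R po

  last : n ∸ 1 < n
  last = last<n (2<⇒1≤ 3≤n)

  lastDepth : ℕ
  lastDepth = depth (n ∸ 1) last

  truncation-exists : ∃[ k ] ∃[ n' ] Trunc n R k n'
  truncation-exists with leastBelow (λ i → 1 ≤ i × Dep n R i lastDepth) (λ i → (1 ≤? i) ×-dec dep? i lastDepth) n
  ... | inj₂ none = ⊥-elim (none (n ∸ 1) last (n≢0⇒n>0 (last≢0 3≤n) , depth-spec last))
  ... | inj₁ (n' , _ , (1≤n' , Dn') , below) = lastDepth , n' , depth-spec last , λ i i<n → low i i<n , high i i<n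
    where
      low : ∀ i → i < n → i < n' → ¬ Dep n R i lastDepth
      low zero _ _ D = <-irrefl refl (dep-decreasing 0<n (least (n ∸ 1) last , λ e → last≢0 3≤n (sym e)) D (depth-spec last))
      low (suc i) _ i<n' D = below (suc i) i<n' (s≤s z≤n , D)
      high : ∀ i → i < n → ¬ Dep n R i lastDepth → i < n'
      high i i<n ¬D with i <? n'
      ... | yes i<n' = i<n'
      ... | no i≮n' = ⊥-elim (¬D (subst (Dep n R i) (≤-antisym dᵢ≤k k≤dᵢ) (depth-spec i<n)))
        where
          dᵢ = depth i i<n
          k≤dᵢ = lev n' i lastDepth dᵢ 1≤n' (≮⇒≥ i≮n') i<n Dn' (depth-spec i<n)
          dᵢ≤k = lev i (n ∸ 1) dᵢ lastDepth (≤-trans 1≤n' (≮⇒≥ i≮n')) (≤last i<n) last (depth-spec i<n) (depth-spec last)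

module Truncated (n : ℕ) (R : Ord) (po : IsNPoset n R) (lev : IsLevellised n R) (3≤n : 3 ≤ n)
                 (k n' : ℕ) (Tr : Trunc n R k n') where
  open IsNPoset po
  open Poset n R po

  1≤k : 1 ≤ k
  1≤k = last-depth-pos 3≤n (proj₁ Tr)

  n'<n : n' < n
  n'<n = trunc-bound (2<⇒1≤ 3≤n) Tr

  -- 1 has depth 0 ≠ k, so it lies in L'.
  1<n' : 1 < n'
  1<n' = proj₂ (proj₂ Tr 1 1<n) λ D → <-irrefl refl (subst (1 ≤_) (dep-unique D dep-top) 1≤k)

  last-level-depth : n' ≤ j → j < n → Dep n R j k
  last-level-depth {j} n'≤j j<n with dep? j k
  ... | yes D = D
  ... | no ¬D = ⊥-elim (<-irrefl refl (<-≤-trans (proj₂ (proj₂ Tr j j<n) ¬D) n'≤j))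

  truncated-depth : a < n' → a ≢ 0 → Dep n R a p → p < k
  truncated-depth {a} {p} a<n' a≢0 D =
    ≤∧≢⇒< (lev a (n ∸ 1) p k (n≢0⇒n>0 a≢0) (≤last a<n) (last<n (2<⇒1≤ 3≤n)) D (proj₁ Tr))
          (λ { refl → proj₁ (proj₂ Tr a a<n) a<n' D })
    where a<n = <-trans a<n' n'<n

  depth<k⇒truncated : a < n → Dep n R a p → p < k → a < n'
  depth<k⇒truncated a<n D p<k = proj₂ (proj₂ Tr _ a<n) λ D' → <-irrefl (dep-unique D D') p<k

  above-nonzero : a < n → a ≢ 0 → T (R a b) → b ≢ 0
  above-nonzero {a} a<n a≢0 a⪯b refl = a≢0 (antisym a 0 a<n 0<n a⪯b (least a a<n))

  -- Chains starting at a nonzero element of L' stay inside L', since depth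
  -- decreases along them.
  chain-restrict : SChain n R a c m → a ≢ 0 → Dep n R a p → p < k → SChain n' R a c m
  chain-restrict (single a<n) a≢0 D p<k = single (depth<k⇒truncated a<n D p<k)
  chain-restrict (step a<n a≺b ch) a≢0 D p<k =
    step (depth<k⇒truncated a<n D p<k) a≺b
         (chain-restrict ch (above-nonzero a<n a≢0 (proj₁ a≺b)) Db (<-trans (dep-decreasing a<n a≺b D Db) p<k))
    where Db = depth-spec (chain-start ch)

  chain-extend : SChain n' R a c m → SChain n R a c m
  chain-extend (single a<n') = single (<-trans a<n' n'<n)
  chain-extend (step a<n' a≺b ch) = step (<-trans a<n' n'<n) a≺b (chain-extend ch)

  dep-restrict : a < n' → a ≢ 0 → Dep n R a p → Dep n' R a p
  dep-restrict a<n' a≢0 D@(ch , longest) =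
    chain-restrict ch a≢0 D (truncated-depth a<n' a≢0 D) , λ m ch' → longest m (chain-extend ch')

  dep-extend : a < n' → a ≢ 0 → Dep n' R a p → Dep n R a p
  dep-extend {a} a<n' a≢0 D' =
    subst (Dep n R a) (dep-unique (dep-restrict a<n' a≢0 D) D') D
    where D = depth-spec (<-trans a<n' n'<n)

  poset' : IsNPoset n' R
  poset' = record
    { two≤n = 1<n'
    ; refl' = λ a a<n' → refl' a (<-trans a<n' n'<n)
    ; antisym = λ a b a<n' b<n' → antisym a b (<-trans a<n' n'<n) (<-trans b<n' n'<n)
    ; trans' = λ a b c a<n' b<n' c<n' → trans' a b c (<-trans a<n' n'<n) (<-trans b<n' n'<n) (<-trans c<n' n'<n)
    ; least = λ a a<n' → least a (<-trans a<n' n'<n)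
    ; greatest = λ a a<n' → greatest a (<-trans a<n' n'<n)
    }

  levellised' : IsLevellised n' R
  levellised' i j p q 0<i i≤j j<n' Di Dj =
    lev i j p q 0<i i≤j (<-trans j<n' n'<n)
        (dep-extend (≤-<-trans i≤j j<n') (λ { refl → <-irrefl refl 0<i }) Di)
        (dep-extend j<n' (λ { refl → <-irrefl refl (<-≤-trans 0<i i≤j) }) Dj)

-- Reconstruction: L' and the covers of the last level determine L

module Reconstruction (n : ℕ) (R₁ R₂ : Ord) (po₁ : IsNPoset n R₁) (po₂ : IsNPoset n R₂)
    (lev₁ : IsLevellised n R₁) (lev₂ : IsLevellised n R₂) (3≤n : 3 ≤ n) (k n' : ℕ)
    (Tr₁ : Trunc n R₁ k n') (Tr₂ : Trunc n R₂ k n') (E : EqOn n' R₁ R₂)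
    (covers-included : ∀ d j → 1 ≤ d → d < k → n' ≤ j → j < n → ∀ c → c < n → CovD n R₁ j d c → CovD n R₂ j d c) where
  private
    module P₁ = Poset n R₁ po₁
    module P₂ = Poset n R₂ po₂
    module T₁ = Truncated n R₁ po₁ lev₁ 3≤n k n' Tr₁
    module T₂ = Truncated n R₂ po₂ lev₂ 3≤n k n' Tr₂

  -- Every cover of a last-level element in R₁ is one in R₂.  A cover of
  -- depth 0 is the top 1, which is covered exactly by the elements of
  -- depth 1 (here k = 1) in both orders.
  last-level-covers : n' ≤ j → j < n → Covers n R₁ j c → Covers n R₂ j c
  last-level-covers {j} {c} n'≤j j<n cov with P₁.depth-exists (proj₁ (proj₂ cov))
  ... | suc d , Dc = proj₁ (covers-included (suc d) j (s≤s z≤n) d<k n'≤j j<n c (proj₁ (proj₂ cov)) (cov , Dc))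
    where d<k = P₁.dep-decreasing j<n (proj₁ (proj₂ (proj₂ cov))) (T₁.last-level-depth n'≤j j<n) Dc
  ... | zero , Dc with P₁.dep-zero Dc
  ...   | refl = P₂.depth-one⇒covers-top j<n
                   (subst (Dep n R₂ j) (P₁.covers-top⇒depth-one cov (T₁.last-level-depth n'≤j j<n)) (T₂.last-level-depth n'≤j j<n))

  -- Below a last-level element b only 0 lies in L', since depth
  -- decreases along ≺ and the nonzero elements of L' have depth below k.
  truncated-below-last : a < n → b < n → a < n' → ¬ b < n' → T (R₁ a b) → T (R₂ a b)
  truncated-below-last {a} {b} a<n b<n a<n' b≮n' a⪯b with a ≟ 0
  ... | yes refl = IsNPoset.least po₂ b b<n
  ... | no a≢0 = ⊥-elim (<-irrefl refl (<-trans (P₁.dep-decreasing a<n (a⪯b , λ { refl → b≮n' a<n' }) Da Db)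
                                               (T₁.truncated-depth a<n' a≢0 Da)))
    where
      Da = P₁.depth-spec a<n
      Db = T₁.last-level-depth (≮⇒≥ b≮n') b<n

  -- Above a last-level element a, an element b of L' lies above a cover c
  -- of a; c has smaller depth, so it lies in L', and it covers a in R₂.
  last-below-truncated : a < n → b < n → ¬ a < n' → b < n' → T (R₁ a b) → T (R₂ a b)
  last-below-truncated {a} {b} a<n b<n a≮n' b<n' a⪯b with P₁.cover-below a<n b<n (a⪯b , λ { refl → a≮n' b<n' })
  ... | c , cov@(_ , c<n , a≺c , _) , c⪯b =
    IsNPoset.trans' po₂ a c b a<n c<n b<n a⪯₂c (subst T (E c b c<n' b<n') c⪯b)
    where
      Da = T₁.last-level-depth (≮⇒≥ a≮n') a<n
      Dc = P₁.depth-spec c<n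
      c<n' = T₁.depth<k⇒truncated c<n Dc (P₁.dep-decreasing a<n a≺c Da Dc)
      a⪯₂c = proj₁ (proj₁ (proj₂ (proj₂ (last-level-covers (≮⇒≥ a≮n') a<n cov))))

  -- Distinct last-level elements are incomparable, having equal depth.
  within-last-level : a < n → b < n → ¬ a < n' → ¬ b < n' → T (R₁ a b) → T (R₂ a b)
  within-last-level {a} {b} a<n b<n a≮n' b≮n' a⪯b with a ≟ b
  ... | yes refl = IsNPoset.refl' po₂ a a<n
  ... | no a≢b = ⊥-elim (<-irrefl refl (P₁.dep-decreasing a<n (a⪯b , a≢b) (T₁.last-level-depth (≮⇒≥ a≮n') a<n)
                                                          (T₁.last-level-depth (≮⇒≥ b≮n') b<n)))

  order-included : a < n → b < n → T (R₁ a b) → T (R₂ a b)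
  order-included {a} {b} a<n b<n a⪯b with a <? n' | b <? n'
  ... | yes a<n' | yes b<n' = subst T (E a b a<n' b<n') a⪯b
  ... | yes a<n' | no b≮n' = truncated-below-last a<n b<n a<n' b≮n' a⪯b
  ... | no a≮n' | yes b<n' = last-below-truncated a<n b<n a≮n' b<n' a⪯b
  ... | no a≮n' | no b≮n' = within-last-level a<n b<n a≮n' b≮n' a⪯b

-- The first difference of two tables W₁ W₂, indexed by depths 1 ≤ d < k
-- (scanned from the largest) and labels n' ≤ j < n (scanned from the
-- smallest), as in the definition of <.
record FirstDifference (W₁ W₂ : ℕ → ℕ → ℕ) (k n' n : ℕ) : Set where
  field
    level index : ℕ
    1≤level : 1 ≤ level
    level<k : level < k
    n'≤index : n' ≤ index
    index<n : index < n
    agree-above : ∀ d j → level < d → d < k → n' ≤ j → j < n → W₁ d j ≡ W₂ d j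
    agree-before : ∀ j → n' ≤ j → j < index → W₁ level j ≡ W₂ level j
    differ : W₁ level index ≢ W₂ level index

open FirstDifference using (level; index)

firstDifference-sym : ∀ {W₁ W₂} → FirstDifference W₁ W₂ k n' n → FirstDifference W₂ W₁ k n' n
firstDifference-sym fd = record
  { level = level fd ; index = index fd ; 1≤level = 1≤level ; level<k = level<k
  ; n'≤index = n'≤index ; index<n = index<n
  ; agree-above = λ d j ℓ<d d<k n'≤j j<n → sym (agree-above d j ℓ<d d<k n'≤j j<n)
  ; agree-before = λ j n'≤j j<i → sym (agree-before j n'≤j j<i)
  ; differ = λ e → differ (sym e)
  }
  where open FirstDifference fd hiding (level; index)

-- Two tables agree everywhere or have a first difference: take the
-- largest depth with a difference, then the least label there.
compare-tables : (W₁ W₂ : ℕ → ℕ → ℕ) (k n' n : ℕ) →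
  (∀ d j → 1 ≤ d → d < k → n' ≤ j → j < n → W₁ d j ≡ W₂ d j) ⊎ FirstDifference W₁ W₂ k n' n
compare-tables W₁ W₂ k n' n with greatestBelow DiffersAt (λ d → (1 ≤? d) ×-dec differs-somewhere? d) k
  where
    Differs : ℕ → ℕ → Set
    Differs d j = n' ≤ j × W₁ d j ≢ W₂ d j
    DiffersAt : ℕ → Set
    DiffersAt d = 1 ≤ d × ∃[ j ] j < n × Differs d j
    differs-somewhere? : ∀ d → Dec (∃[ j ] j < n × Differs d j)
    differs-somewhere? d = anyUpTo? (λ j → (n' ≤? j) ×-dec ¬? (W₁ d j ≟ W₂ d j)) n
... | inj₂ none = inj₁ λ d j 1≤d d<k n'≤j j<n →
        decidable-stable (W₁ d j ≟ W₂ d j) λ ne → none d d<k (1≤d , j , j<n , n'≤j , ne)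
... | inj₁ (ℓ , ℓ<k , (1≤ℓ , j₀ , j₀<n , n'≤j₀ , ne₀) , above)
  with leastBelow (λ j → n' ≤ j × W₁ ℓ j ≢ W₂ ℓ j) (λ j → (n' ≤? j) ×-dec ¬? (W₁ ℓ j ≟ W₂ ℓ j)) n
...   | inj₂ none = ⊥-elim (none j₀ j₀<n (n'≤j₀ , ne₀))
...   | inj₁ (i , i<n , (n'≤i , neᵢ) , before) = inj₂ record
  { level = ℓ ; index = i ; 1≤level = 1≤ℓ ; level<k = ℓ<k ; n'≤index = n'≤i ; index<n = i<n
  ; agree-above = λ d j ℓ<d d<k n'≤j j<n → decidable-stable (W₁ d j ≟ W₂ d j)
      λ ne → above d ℓ<d d<k (≤-trans 1≤ℓ (<⇒≤ ℓ<d) , j , j<n , n'≤j , ne)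
  ; agree-before = λ j n'≤j j<i → decidable-stable (W₁ ℓ j ≟ W₂ ℓ j) λ ne → before j j<i (n'≤j , ne)
  ; differ = neᵢ
  }

T-injective : ∀ x y → (T x → T y) → (T y → T x) → x ≡ y
T-injective false false _ _ = refl
T-injective false true _ y⇒x = ⊥-elim (y⇒x tt)
T-injective true false x⇒y _ = ⊥-elim (x⇒y tt)
T-injective true true _ _ = refl

-- Equal weights on the last level give equal covers there (binary
-- expansions are unique), hence equal orders by reconstruction.
same-weights⇒equal : (po₁ : IsNPoset n R₁) (po₂ : IsNPoset n R₂) (lev₁ : IsLevellised n R₁) (lev₂ : IsLevellised n R₂)
  (3≤n : 3 ≤ n) (T₁ : Trunc n R₁ k n') (T₂ : Trunc n R₂ k n') → EqOn n' R₁ R₂ →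
  (∀ d j → 1 ≤ d → d < k → n' ≤ j → j < n → Poset.weight n R₁ po₁ d j ≡ Poset.weight n R₂ po₂ d j) →
  EqOn n R₁ R₂
same-weights⇒equal {n} {R₁} {R₂} {k} {n'} po₁ po₂ lev₁ lev₂ 3≤n T₁ T₂ E same a b a<n b<n =
  T-injective (R₁ a b) (R₂ a b) (R₁⊆R₂.order-included a<n b<n) (R₂⊆R₁.order-included a<n b<n)
  where
    module P₁ = Poset n R₁ po₁
    module P₂ = Poset n R₂ po₂
    module R₁⊆R₂ = Reconstruction n R₁ R₂ po₁ po₂ lev₁ lev₂ 3≤n k n' T₁ T₂ E
      (λ d j 1≤d d<k n'≤j j<n → wt-reflects (P₁.weight-spec d j) (P₂.weight-spec d j) (same d j 1≤d d<k n'≤j j<n))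
    module R₂⊆R₁ = Reconstruction n R₂ R₁ po₂ po₁ lev₂ lev₁ 3≤n k n' T₂ T₁ (eqOn-sym E)
      (λ d j 1≤d d<k n'≤j j<n → wt-reflects (P₂.weight-spec d j) (P₁.weight-spec d j) (sym (same d j 1≤d d<k n'≤j j<n)))

levelLess-of-difference : ∀ {W₁ W₂} → (∀ d j → WtIs (CovD n R₁ j d) n (W₁ d j)) → (∀ d j → WtIs (CovD n R₂ j d) n (W₂ d j)) →
  (fd : FirstDifference W₁ W₂ k n' n) → W₁ (level fd) (index fd) < W₂ (level fd) (index fd) → LevelLess n k n' R₁ R₂
levelLess-of-difference {n} {W₁ = W₁} W₁-spec W₂-spec
  record { level = ℓ ; index = i ; 1≤level = 1≤ℓ ; level<k = ℓ<k ; n'≤index = n'≤i ; index<n = i<n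
         ; agree-above = above ; agree-before = before } lt =
  ℓ , i , 1≤ℓ , ℓ<k , n'≤i , i<n ,
  (λ d j ℓ<d d<k n'≤j j<n → same d j (above d j ℓ<d d<k n'≤j j<n)) ,
  (λ j n'≤j j<i → same ℓ j (before j n'≤j j<i)) ,
  (_ , _ , W₁-spec ℓ i , W₂-spec ℓ i , lt)
  where
    same : ∀ d j → W₁ d j ≡ _ → SameWt n _ _ d j
    same d j e = W₁ d j , W₁-spec d j , subst (WtIs _ n) (sym e) (W₂-spec d j)

first-difference-decides : ∀ {W₁ W₂} → (∀ d j → WtIs (CovD n R₁ j d) n (W₁ d j)) → (∀ d j → WtIs (CovD n R₂ j d) n (W₂ d j)) →
  FirstDifference W₁ W₂ k n' n → LevelLess n k n' R₁ R₂ ⊎ LevelLess n k n' R₂ R₁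
first-difference-decides {W₁ = W₁} {W₂} W₁-spec W₂-spec fd with <-cmp (W₁ (level fd) (index fd)) (W₂ (level fd) (index fd))
... | tri< lt _ _ = inj₁ (levelLess-of-difference W₁-spec W₂-spec fd lt)
... | tri≈ _ eq _ = ⊥-elim (FirstDifference.differ fd eq)
... | tri> _ _ gt = inj₂ (levelLess-of-difference W₂-spec W₁-spec (firstDifference-sym fd) gt)

compare-last-level : (po₁ : IsNPoset n R₁) (po₂ : IsNPoset n R₂) → IsLevellised n R₁ → IsLevellised n R₂ → 3 ≤ n →
  Trunc n R₁ k n' → Trunc n R₂ k n' → EqOn n' R₁ R₂ →
  LevelLess n k n' R₁ R₂ ⊎ EqOn n R₁ R₂ ⊎ LevelLess n k n' R₂ R₁
compare-last-level {n} {R₁} {R₂} {k} {n'} po₁ po₂ lev₁ lev₂ 3≤n T₁ T₂ E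
  with compare-tables (Poset.weight n R₁ po₁) (Poset.weight n R₂ po₂) k n' n
... | inj₁ same = inj₂ (inj₁ (same-weights⇒equal po₁ po₂ lev₁ lev₂ 3≤n T₁ T₂ E same))
... | inj₂ fd with first-difference-decides (Poset.weight-spec n R₁ po₁) (Poset.weight-spec n R₂ po₂) fd
...   | inj₁ LL = inj₁ LL
...   | inj₂ LL = inj₂ (inj₂ LL)

-- Trichotomy

-- Any two 2-posets are equal: the order on {0,1} is forced.
two-element-⊆ : IsNPoset 2 R₁ → IsNPoset 2 R₂ → a < 2 → b < 2 → T (R₁ a b) → T (R₂ a b)
two-element-⊆ {a = 0} {b} _ po₂ _ b<2 _ = IsNPoset.least po₂ b b<2
two-element-⊆ {a = 1} {1} _ po₂ 1<2 _ _ = IsNPoset.refl' po₂ 1 1<2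
two-element-⊆ {a = 1} {0} po₁ _ 1<2 0<2 1⪯0 with IsNPoset.antisym po₁ 1 0 1<2 0<2 1⪯0 (IsNPoset.least po₁ 1 1<2)
... | ()
two-element-⊆ {a = 1} {suc (suc _)} _ _ _ (s≤s (s≤s ())) _
two-element-⊆ {a = suc (suc _)} _ _ (s≤s (s≤s ())) _ _

two-element-equal : IsNPoset 2 R₁ → IsNPoset 2 R₂ → EqOn 2 R₁ R₂
two-element-equal {R₁} {R₂} po₁ po₂ a b a<2 b<2 =
  T-injective (R₁ a b) (R₂ a b) (two-element-⊆ po₁ po₂ a<2 b<2) (two-element-⊆ po₂ po₁ a<2 b<2)

-- The inductive step: for orders truncated at the same (k, n'), a
-- trichotomy for the truncations gives one for the orders, by the first
-- clause of < if the truncations differ and by comparing the last level if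
-- they are equal.
trichotomy-step : ∀ fuel → IsNPoset n R₁ → IsNPoset n R₂ → IsLevellised n R₁ → IsLevellised n R₂ → 3 ≤ n →
  Trunc n R₁ k n' → Trunc n R₂ k n' →
  LessF fuel n' R₁ R₂ ⊎ EqOn n' R₁ R₂ ⊎ LessF fuel n' R₂ R₁ →
  LessF (suc fuel) n R₁ R₂ ⊎ EqOn n R₁ R₂ ⊎ LessF (suc fuel) n R₂ R₁
trichotomy-step {k = k} {n'} fuel _ _ _ _ 3≤n T₁ T₂ (inj₁ L') = inj₁ (3≤n , inj₁ (k , k , n' , T₁ , T₂ , L'))
trichotomy-step {k = k} {n'} fuel _ _ _ _ 3≤n T₁ T₂ (inj₂ (inj₂ L')) = inj₂ (inj₂ (3≤n , inj₁ (k , k , n' , T₂ , T₁ , L')))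
trichotomy-step {k = k} {n'} fuel po₁ po₂ lev₁ lev₂ 3≤n T₁ T₂ (inj₂ (inj₁ E)) with compare-last-level po₁ po₂ lev₁ lev₂ 3≤n T₁ T₂ E
... | inj₁ LL = inj₁ (3≤n , inj₂ (k , n' , T₁ , T₂ , E , LL))
... | inj₂ (inj₁ equal) = inj₂ (inj₁ equal)
... | inj₂ (inj₂ LL) = inj₂ (inj₂ (3≤n , inj₂ (k , n' , T₂ , T₁ , eqOn-sym E , LL)))

common-truncation : IsNPoset n R₁ → IsNPoset n R₂ → IsLevellised n R₁ → IsLevellised n R₂ → 3 ≤ n →
  Iso n R₁ R₂ → ∃[ k ] ∃[ n' ] Trunc n R₁ k n' × Trunc n R₂ k n'
common-truncation {n} {R₁} {R₂} po₁ po₂ lev₁ lev₂ 3≤n iso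
  with Levellised.truncation-exists n R₁ po₁ lev₁ 3≤n | Levellised.truncation-exists n R₂ po₂ lev₂ 3≤n
... | k , n' , T₁ | _ , _ , T₂ with iso-same-truncation po₁ po₂ lev₁ lev₂ 3≤n iso T₁ T₂
...   | refl , refl = k , n' , T₁ , T₂

-- Trichotomy for isomorphic levellised n-posets, by induction on a fuel
-- bounding n: for n ≥ 3 the truncations are isomorphic levellised
-- n'-posets with n' < n.
trichotomy : ∀ fuel n → n ≤ fuel → IsNPoset n R₁ → IsNPoset n R₂ → IsLevellised n R₁ → IsLevellised n R₂ →
  Iso n R₁ R₂ → LessF fuel n R₁ R₂ ⊎ EqOn n R₁ R₂ ⊎ LessF fuel n R₂ R₁
trichotomy fuel 0 _ po₁ _ _ _ _ with IsNPoset.two≤n po₁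
... | ()
trichotomy fuel 1 _ po₁ _ _ _ _ with IsNPoset.two≤n po₁
... | s≤s ()
trichotomy fuel 2 _ po₁ po₂ _ _ _ = inj₂ (inj₁ (two-element-equal po₁ po₂))
trichotomy {R₁} {R₂} (suc fuel) n@(suc (suc (suc _))) n≤1+fuel po₁ po₂ lev₁ lev₂ iso =
  by-truncations (common-truncation po₁ po₂ lev₁ lev₂ 3≤3+ iso)
  where
    by-truncations : ∃[ k ] ∃[ n' ] Trunc n R₁ k n' × Trunc n R₂ k n' →
      LessF (suc fuel) n R₁ R₂ ⊎ EqOn n R₁ R₂ ⊎ LessF (suc fuel) n R₂ R₁
    by-truncations (k , n' , T₁ , T₂) = trichotomy-step fuel po₁ po₂ lev₁ lev₂ 3≤3+ T₁ T₂
      (trichotomy fuel n' (≤-pred (<-≤-trans T.n'<n n≤1+fuel)) T.poset' T'.poset' T.levellised' T'.levellised'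
                  (iso-restrict po₁ po₂ iso T₁ T₂))
      where
        module T = Truncated n R₁ po₁ lev₁ 3≤3+ k n' T₁
        module T' = Truncated n R₂ po₂ lev₂ 3≤3+ k n' T₂

lemma3p5 : (n : ℕ) → 2 ≤ n → (R₀ : Ord) →
    ((R : Ord) → InClass n R₀ R → ¬ Less n R R) ×
    ((R₁ R₂ R₃ : Ord) → InClass n R₀ R₁ → InClass n R₀ R₂ → InClass n R₀ R₃ →
       Less n R₁ R₂ → Less n R₂ R₃ → Less n R₁ R₃) ×
    ((R₁ R₂ : Ord) → InClass n R₀ R₁ → InClass n R₀ R₂ →
       Less n R₁ R₂ ⊎ EqOn n R₁ R₂ ⊎ Less n R₂ R₁)
lemma3p5 n _ R₀ = irreflexive , transitive , trichotomous
  where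
    irreflexive : (R : Ord) → InClass n R₀ R → ¬ Less n R R
    irreflexive R _ = lessF-irrefl n

    transitive : (R₁ R₂ R₃ : Ord) → InClass n R₀ R₁ → InClass n R₀ R₂ → InClass n R₀ R₃ →
      Less n R₁ R₂ → Less n R₂ R₃ → Less n R₁ R₃
    transitive R₁ R₂ R₃ _ _ _ = lessF-trans n

    -- Members of the class are isomorphic to each other via R₀.
    trichotomous : (R₁ R₂ : Ord) → InClass n R₀ R₁ → InClass n R₀ R₂ → Less n R₁ R₂ ⊎ EqOn n R₁ R₂ ⊎ Less n R₂ R₁
    trichotomous R₁ R₂ (((po₁ , _) , lev₁) , R₀≅R₁) (((po₂ , _) , lev₂) , R₀≅R₂) =
      trichotomy n n ≤-refl po₁ po₂ lev₁ lev₂ (iso-trans {R₁ = R₁} {R₂ = R₀} {R₃ = R₂} (iso-sym {R₁ = R₀} {R₂ = R₁} R₀≅R₁) R₀≅R₂)
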